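{- Let $\mathfrak{M}=(S,\backsim,V)$ be a pseudo model and $G$ a group. Then $\mathfrak{M}|_G$ is a pseudo model.
   Context: Fix a finite set $\textsc{ag}$ of agents and a set $\textsc{prop}$ of propositional variables; $\textsc{gr}$ is the set of nonempty subsets of $\textsc{ag}$. A pre-model is $\mathfrak{M}=(S,\backsim,V)$ where $S$ is a nonempty set, $\backsim$ assigns to every agent $i$ an equivalence relation $\backsim_i$ on $S$ and to every group $G\in\textsc{gr}$ an equivalence relation $\backsim_G$ on $S$ (these are primitive, not defined from the $\backsim_i$), and $V:\textsc{prop}\to\wp(S)$. A pseudo model is a pre-model such that $\backsim_{\{i\}}=\backsim_i$ for every agent $i$, and $G\subseteq H$ implies $\backsim_H\subseteq\backsim_G$. For a pre-model $\mathfrak{M}$ and group $G$, the update $\mathfrak{M}|_G=(S,\backsim|_G,V)$ is given by $(\backsim|_G)_i=\backsim_G$ if $i\in G$ and $\backsim_i$ otherwise, and $(\backsim|_G)_H=\backsim_{H\cup G}$ if $H\cap G\neq\emptyset$ and $\backsim_H$ otherwise. -}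

module Defs where

open import Level using (Level; _⊔_; suc)
open import Data.Nat using (ℕ)
open import Data.Fin using (Fin)
open import Data.Fin.Subset using (Subset; _∪_; _∩_; _⊆_; Nonempty; ⁅_⁆; _∈_)
open import Data.Fin.Subset.Properties using (x∈⁅x⁆)
open import Data.Product using (Σ; _,_; proj₁; proj₂)
open import Relation.Binary.Core using (Rel)
open import Relation.Binary.Definitions using () renaming (Decidable to Dec₂)
open import Relation.Binary.Structures using (IsEquivalence)
open import Relation.Nullary using (Dec; yes; no; ¬_)
open import Relation.Unary using (Pred)

Group : ℕ → Set
Group n = Σ (Subset n) Nonempty

single : ∀ {n} → Fin n → Group n
single i = ⁅ i ⁆ , (i , x∈⁅x⁆ i)

_∪ᴳ_ : ∀ {n} → Group n → Group n → Group n
(H , _) ∪ᴳ (G , (x , x∈G)) = (H ∪ G) , (x , Data.Fin.Subset.Properties.q⊆p∪q H G x∈G)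

_⊆ᴿ_ : ∀ {a ℓ₁ ℓ₂} {A : Set a} → Rel A ℓ₁ → Rel A ℓ₂ → Set (a ⊔ ℓ₁ ⊔ ℓ₂)
R ⊆ᴿ Q = ∀ {x y} → R x y → Q x y

_≐ᴿ_ : ∀ {a ℓ₁ ℓ₂} {A : Set a} → Rel A ℓ₁ → Rel A ℓ₂ → Set (a ⊔ ℓ₁ ⊔ ℓ₂)
R ≐ᴿ Q = (R ⊆ᴿ Q) Data.Product.× (Q ⊆ᴿ R)

-- Pre-model over n agents and propositional variables Prop.
-- The group relations are primitive (not defined from the agent relations).
record PreModel {s ℓ} (n : ℕ) (Prop : Set) : Set (Level.suc (s ⊔ ℓ)) where
  field
    S       : Set s
    inhabitant : S
    agRel   : Fin n → Rel S ℓ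
    agEquiv : ∀ i → IsEquivalence (agRel i)
    grRel   : Group n → Rel S ℓ
    grEquiv : ∀ G → IsEquivalence (grRel G)
    V       : Prop → Pred S ℓ

record IsPseudo {s ℓ} {n : ℕ} {Prop : Set} (M : PreModel {s} {ℓ} n Prop) : Set (s ⊔ ℓ) where
  open PreModel M
  field
    single-eq : ∀ i → grRel (single i) ≐ᴿ agRel i
    antitone  : ∀ (G H : Group n) → proj₁ G ⊆ proj₁ H → grRel H ⊆ᴿ grRel G

open import Data.Fin.Subset.Properties using (_∈?_)
open import Data.Fin.Subset using (Empty)

nonempty? : ∀ {n} (p : Subset n) → Dec (Nonempty p)
nonempty? p = Data.Fin.Subset.Properties.nonempty? p

update : ∀ {s ℓ n Prop} → PreModel {s} {ℓ} n Prop → Group n → PreModel {s} {ℓ} n Prop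
update {n = n} M G = record
  { S = S
  ; inhabitant = inhabitant
  ; agRel = agRel′
  ; agEquiv = agEquiv′
  ; grRel = grRel′
  ; grEquiv = grEquiv′
  ; V = V
  }
  where
  open PreModel M
  agRel′ : Fin n → Rel S _
  agRel′ i with i ∈? proj₁ G
  ... | yes _ = grRel G
  ... | no _  = agRel i
  agEquiv′ : ∀ i → IsEquivalence (agRel′ i)
  agEquiv′ i with i ∈? proj₁ G
  ... | yes _ = grEquiv G
  ... | no _  = agEquiv i
  grRel′ : Group n → Rel S _
  grRel′ H with nonempty? (proj₁ H ∩ proj₁ G)
  ... | yes _ = grRel (H ∪ᴳ G)
  ... | no _  = grRel H
  grEquiv′ : ∀ H → IsEquivalence (grRel′ H)
  grEquiv′ H with nonempty? (proj₁ H ∩ proj₁ G)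
  ... | yes _ = grEquiv (H ∪ᴳ G)
  ... | no _  = grEquiv H

-- Both conditions reduce to antitonicity in M. For i ∈ G the sets {i} ∪ G and G
-- coincide, so ∼_{{i}∪G} = ∼_G. Meeting G is upward closed, so for H ⊆ K the
-- case "H meets G but K does not" cannot occur; in the other cases H ∪ G ⊆ K ∪ G,
-- H ⊆ K ∪ G or H ⊆ K.
module Submission where

open import Defs
open import Data.Nat using (ℕ)
open import Data.Fin using (Fin)
open import Data.Fin.Subset using (Subset; _∪_; _∩_; _⊆_; Nonempty; ⁅_⁆; _∈_)
open import Data.Fin.Subset.Properties
  using (_∈?_; x∈⁅x⁆; x∈⁅y⁆⇒x≡y; p⊆p∪q; q⊆p∪q; ⊆-refl; x∈p∪q⁻; x∈p∩q⁺; x∈p∩q⁻)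
open import Data.Product using (_,_; proj₁; proj₂)
open import Data.Sum using ([_,_])
open import Relation.Nullary using (yes; no; contradiction)
open import Relation.Binary.PropositionalEquality using (subst; sym)

module _ {n : ℕ} where

  ∪-lub : ∀ {p q r : Subset n} → p ⊆ r → q ⊆ r → p ∪ q ⊆ r
  ∪-lub {p} {q} p⊆r q⊆r x∈p∪q = [ p⊆r , q⊆r ] (x∈p∪q⁻ p q x∈p∪q)

  ∪-monoˡ-⊆ : ∀ {p q : Subset n} (r : Subset n) → p ⊆ q → p ∪ r ⊆ q ∪ r
  ∪-monoˡ-⊆ {q = q} r p⊆q = ∪-lub (λ x∈p → p⊆p∪q r (p⊆q x∈p)) (q⊆p∪q q r)

  ∩-monoˡ-⊆ : ∀ {p q : Subset n} (r : Subset n) → p ⊆ q → p ∩ r ⊆ q ∩ r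
  ∩-monoˡ-⊆ {p} r p⊆q x∈p∩r =
    x∈p∩q⁺ (p⊆q (proj₁ (x∈p∩q⁻ p r x∈p∩r)) , proj₂ (x∈p∩q⁻ p r x∈p∩r))

  Nonempty-mono : ∀ {p q : Subset n} → p ⊆ q → Nonempty p → Nonempty q
  Nonempty-mono p⊆q (x , x∈p) = x , p⊆q x∈p

  x∈p⇒⁅x⁆⊆p : ∀ {x : Fin n} {p : Subset n} → x ∈ p → ⁅ x ⁆ ⊆ p
  x∈p⇒⁅x⁆⊆p {x} x∈p y∈⁅x⁆ = subst (_∈ _) (sym (x∈⁅y⁆⇒x≡y x y∈⁅x⁆)) x∈p

  x∈p⇒Nonempty[⁅x⁆∩p] : ∀ {x : Fin n} {p : Subset n} → x ∈ p → Nonempty (⁅ x ⁆ ∩ p)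
  x∈p⇒Nonempty[⁅x⁆∩p] {x} x∈p = x , x∈p∩q⁺ (x∈⁅x⁆ x , x∈p)

  Nonempty[⁅x⁆∩p]⇒x∈p : ∀ {x : Fin n} {p : Subset n} → Nonempty (⁅ x ⁆ ∩ p) → x ∈ p
  Nonempty[⁅x⁆∩p]⇒x∈p {x} {p} (y , y∈⁅x⁆∩p) =
    subst (_∈ p) (x∈⁅y⁆⇒x≡y x (proj₁ y∈⁅x⁆,y∈p)) (proj₂ y∈⁅x⁆,y∈p)
    where y∈⁅x⁆,y∈p = x∈p∩q⁻ ⁅ x ⁆ p y∈⁅x⁆∩p

module _ {s ℓ} {n : ℕ} {Prop : Set} {M : PreModel {s} {ℓ} n Prop} (pseudo : IsPseudo M) where

  open PreModel M
  open IsPseudo pseudo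

  grRel-cong : ∀ (G H : Group n) → proj₁ G ⊆ proj₁ H → proj₁ H ⊆ proj₁ G → grRel G ≐ᴿ grRel H
  grRel-cong G H G⊆H H⊆G = antitone H G H⊆G , antitone G H G⊆H

  module _ (G : Group n) where

    private
      g = proj₁ G
      module M|G = PreModel (update M G)

    update-single-eq : ∀ i → M|G.grRel (single i) ≐ᴿ M|G.agRel i
    update-single-eq i with i ∈? g | nonempty? (⁅ i ⁆ ∩ g)
    ... | yes i∈g | yes _   = grRel-cong (single i ∪ᴳ G) G (∪-lub (x∈p⇒⁅x⁆⊆p i∈g) ⊆-refl) (q⊆p∪q ⁅ i ⁆ g)
    ... | yes i∈g | no ¬ne  = contradiction (x∈p⇒Nonempty[⁅x⁆∩p] i∈g) ¬ne
    ... | no i∉g  | yes ne  = contradiction (Nonempty[⁅x⁆∩p]⇒x∈p ne) i∉g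
    ... | no _    | no _    = single-eq i

    update-antitone : ∀ (H K : Group n) → proj₁ H ⊆ proj₁ K → M|G.grRel K ⊆ᴿ M|G.grRel H
    update-antitone H K H⊆K with nonempty? (proj₁ H ∩ g) | nonempty? (proj₁ K ∩ g)
    ... | yes _  | yes _  = antitone (H ∪ᴳ G) (K ∪ᴳ G) (∪-monoˡ-⊆ g H⊆K)
    ... | yes ne | no ¬ne = contradiction (Nonempty-mono (∩-monoˡ-⊆ g H⊆K) ne) ¬ne
    ... | no _   | yes _  = antitone H (K ∪ᴳ G) (λ x∈H → p⊆p∪q g (H⊆K x∈H))
    ... | no _   | no _   = antitone H K H⊆K

proposition8 : ∀ {s ℓ} {n : ℕ} {Prop : Set} (M : PreModel {s} {ℓ} n Prop) (G : Group n)
             → IsPseudo M → IsPseudo (update M G)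
proposition8 M G pseudo = record
  { single-eq = update-single-eq pseudo G
  ; antitone  = update-antitone pseudo G
  }
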